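{- Let $G$ be a connected graph (with at least two vertices) with cycle rank $r(G)=|E(G)|-|V(G)|+1$. Then $Z(G) \le sdim(G)+3\, r(G)$.
   Context: Graphs are finite, simple, undirected. Zero forcing: color each vertex black or white, with $S$ the initial set of black vertices; the color-change rule turns a white vertex $u_2$ black if it is the only white neighbor of some black vertex. $S$ is a zero forcing set if repeated application eventually makes all vertices black; $Z(G)$ is the minimum size of a zero forcing set. A vertex $x$ strongly resolves $u,v$ if $u$ lies on some shortest $x$–$v$ path or $v$ lies on some shortest $x$–$u$ path; $W$ is a strong resolving set if every pair of distinct vertices is strongly resolved by some vertex of $W$; $sdim(G)$ is the minimum size of a strong resolving set. -}

module Defs where

open import Data.Nat using (ℕ; zero; suc; _+_; _*_; _∸_; _≤_; _<_)
open import Data.Bool using (Bool; true; false; T; _∧_)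
open import Data.Fin using (Fin; toℕ)
open import Data.Fin.Subset using (Subset; _∈_; ∣_∣)
open import Data.List using (List; length; filterᵇ; concatMap; map)
open import Data.List.Base using (allFin)
open import Data.Product using (Σ; ∃; ∃-syntax; _×_; _,_)
open import Data.Sum using (_⊎_)
open import Relation.Binary.PropositionalEquality using (_≡_; _≢_)
open import Relation.Nullary using (¬_)
open import Relation.Nullary.Decidable using (⌊_⌋)
import Data.Nat as ℕ

record Graph (n : ℕ) : Set where
  field
    adj   : Fin n → Fin n → Bool
    sym   : ∀ u v → adj u v ≡ adj v u
    irrefl : ∀ u → adj u u ≡ false
open Graph public

Adj : ∀ {n} → Graph n → Fin n → Fin n → Set
Adj G u v = T (adj G u v)

|V| : ∀ {n} → Graph n → ℕ
|V| {n} _ = n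

|E| : ∀ {n} → Graph n → ℕ
|E| {n} G = length (filterᵇ (λ p → p) (concatMap (λ i → map (λ j → ⌊ toℕ i ℕ.<? toℕ j ⌋ ∧ adj G i j) (allFin n)) (allFin n)))

-- cycle rank r(G) = |E| - |V| + 1  (for connected G, |E| ≥ |V| - 1, so truncated
-- subtraction gives the exact value)
cycleRank : ∀ {n} → Graph n → ℕ
cycleRank G = (|E| G + 1) ∸ |V| G

data Walk {n} (G : Graph n) : Fin n → Fin n → ℕ → Set where
  here : ∀ {u} → Walk G u u zero
  step : ∀ {u w v k} → Adj G u w → Walk G w v k → Walk G u v (suc k)

Connected : ∀ {n} → Graph n → Set
Connected {n} G = ∀ (u v : Fin n) → ∃[ k ] Walk G u v k

IsDist : ∀ {n} → Graph n → Fin n → Fin n → ℕ → Set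
IsDist G u v d = Walk G u v d × (∀ k → Walk G u v k → d ≤ k)

OnShortest : ∀ {n} → Graph n → Fin n → Fin n → Fin n → Set
OnShortest G x u v = ∃[ a ] ∃[ b ] (Walk G x u a × Walk G u v b × IsDist G x v (a + b))

StronglyResolves : ∀ {n} → Graph n → Fin n → Fin n → Fin n → Set
StronglyResolves G x u v = OnShortest G x u v ⊎ OnShortest G x v u

IsStrongResolvingSet : ∀ {n} → Graph n → Subset n → Set
IsStrongResolvingSet {n} G W =
  ∀ (u v : Fin n) → u ≢ v → ∃[ x ] (x ∈ W × StronglyResolves G x u v)

-- vertices that end up black starting from S under the color-change rule
-- (least set containing S closed under: if u is black, v is a neighbour of u
--  and every other neighbour of u is black, then v becomes black)
data Black {n} (G : Graph n) (S : Subset n) : Fin n → Set where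
  init  : ∀ {v} → v ∈ S → Black G S v
  force : ∀ {u v} → Black G S u → Adj G u v →
          (∀ w → Adj G u w → w ≢ v → Black G S w) → Black G S v

IsZeroForcingSet : ∀ {n} → Graph n → Subset n → Set
IsZeroForcingSet {n} G S = ∀ (v : Fin n) → Black G S v

IsMinSize : ∀ {n} → (Subset n → Set) → ℕ → Set
IsMinSize {n} P m = (∃[ S ] (P S × ∣ S ∣ ≡ m)) × (∀ S → P S → m ≤ ∣ S ∣)

IsZ : ∀ {n} → Graph n → ℕ → Set
IsZ G = IsMinSize (IsZeroForcingSet G)

IsSdim : ∀ {n} → Graph n → ℕ → Set
IsSdim G = IsMinSize (IsStrongResolvingSet G)

-- Fix a root ρ, a leaf of G if G has one, and a shortest-path spanning tree
-- rooted at ρ; let every internal tree vertex pick one child, its heir. The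
-- non-heirs together with the vertices having a non-tree edge to a shallower
-- vertex form a zero forcing set: going down by depth, once a parent and all
-- its other neighbours are black, the parent forces its heir. There are as many
-- non-heirs as tree leaves, and a tree leaf other than ρ is a leaf of G or lies
-- on a non-tree edge; with ℓ leaves in G and r ≤ r(G) non-tree edges this bounds
-- the set by (ℓ - 1) + 2r + r. Finally a leaf of G never lies strictly inside a
-- shortest path, so a strong resolving set contains all leaves of G but one,
-- giving ℓ - 1 ≤ sdim(G).

module Submission where

import Algebra.Properties.CommutativeMonoid.Sum as Sum
open import Data.Bool using (Bool; true; false; T; if_then_else_; _∧_)
open import Data.Empty using (⊥)
open import Data.Fin using (Fin; zero; suc; toℕ; _≟_)
open import Data.Fin.Properties using (toℕ-injective; suc-injective; any?; all?)
open import Data.Fin.Subset using (Subset; _∈_; _∉_; ∣_∣)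
open import Data.Fin.Subset.Properties using (_∈?_)
open import Data.List using (List; length; filterᵇ; concat; map; tabulate; allFin; _++_)
open import Data.List.Properties using (map-tabulate; filter-++; length-++)
open import Data.Nat using (ℕ; zero; suc; _+_; _*_; _∸_; _≤_; _<_; z≤n; s≤s; _<?_)
open import Data.Nat.Induction using (<-rec; <-wellFounded)
open import Data.Nat.Properties
  using ( ≤-refl; ≤-trans; ≤-reflexive; +-mono-≤; +-monoˡ-≤; +-monoʳ-≤; m≤m+n; m≤n+m; +-cancelˡ-≤
        ; m≤n+o⇒m∸n≤o; m+n≤o⇒m≤o∸n; <-cmp; ≮⇒≥; <⇒≱; ≰⇒>; +-mono-<; <-irrefl; <-asym; <-trans
        ; <-≤-trans; +-suc; +-comm; +-assoc; +-identityʳ; n≤1+n; *-monoʳ-≤; anyUpTo?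
        ; +-0-commutativeMonoid; module ≤-Reasoning )
open import Data.Product using (∃-syntax; _×_; _,_; proj₁; proj₂)
open import Data.Sum using (_⊎_; inj₁; inj₂; [_,_]) renaming (swap to ⊎-swap)
open import Data.Vec as Vec using ([]; _∷_)
open import Data.Vec.Properties using (lookup⇒[]=; lookup∘tabulate)
open import Function using (_∘_; id)
open import Induction.WellFounded using (module All)
open import Level using (0ℓ)
open import Relation.Binary.Definitions using (tri<; tri≈; tri>)
open import Relation.Binary.PropositionalEquality
  using (_≡_; _≢_; refl; sym; cong; cong₂; trans; subst; module ≡-Reasoning)
import Relation.Binary.Construct.On as On
open import Relation.Nullary using (¬_; Dec; yes; no; does; contradiction)
open import Relation.Nullary.Decidable
  using (¬?; _×-dec_; _⊎-dec_; _→-dec_; ⌊_⌋; T?; isYes≗does; dec-true; map′)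

open import Defs hiding (sym)
open Sum +-0-commutativeMonoid
  using (sum-syntax; sum-cong-≗; ∑-distrib-+; ∑-comm)

-- Counting decidable predicates on Fin n

ι : {P : Set} → Dec P → ℕ
ι P? = if does P? then 1 else 0

ι-yes : {P : Set} (P? : Dec P) → P → ι P? ≡ 1
ι-yes (yes _) _ = refl
ι-yes (no ¬p) p = contradiction p ¬p

ι-no : {P : Set} (P? : Dec P) → ¬ P → ι P? ≡ 0
ι-no (yes p) ¬p = contradiction p ¬p
ι-no (no _) _ = refl

ι-cover : {P Q R : Set} (P? : Dec P) (Q? : Dec Q) (R? : Dec R) →
          (P → Q ⊎ R) → ι P? ≤ ι Q? + ι R?
ι-cover (no _) _ _ _ = z≤n
ι-cover (yes p) Q? R? cover with cover p
... | inj₁ q rewrite ι-yes Q? q = s≤s z≤n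
... | inj₂ r rewrite ι-yes R? r = m≤n+m 1 (ι Q?)

ι-mono : {P Q : Set} (P? : Dec P) (Q? : Dec Q) → (P → Q) → ι P? ≤ ι Q?
ι-mono (no _) Q? _ = z≤n
ι-mono (yes p) Q? P⇒Q rewrite ι-yes Q? (P⇒Q p) = ≤-refl

ι-disjoint : {P Q R : Set} (P? : Dec P) (Q? : Dec Q) (R? : Dec R) →
             (P → Q → ⊥) → (P ⊎ Q → R) → ι P? + ι Q? ≤ ι R?
ι-disjoint (no ¬p) Q? R? _ into = ι-mono Q? R? (into ∘ inj₂)
ι-disjoint (yes p) Q? R? disj into rewrite ι-no Q? (disj p) | ι-yes R? (into (inj₁ p)) = ≤-refl

ι-¬ : {P : Set} (P? : Dec P) → ι P? + ι (¬? P?) ≡ 1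
ι-¬ (yes _) = refl
ι-¬ (no _) = refl

∑-mono-≤ : ∀ {n} {f g : Fin n → ℕ} → (∀ i → f i ≤ g i) → ∑[ i < n ] f i ≤ ∑[ i < n ] g i
∑-mono-≤ {zero} _ = z≤n
∑-mono-≤ {suc n} f≤g = +-mono-≤ (f≤g zero) (∑-mono-≤ (f≤g ∘ suc))

∑-≥-term : ∀ {n} (f : Fin n → ℕ) i → f i ≤ ∑[ j < n ] f j
∑-≥-term f zero = m≤m+n (f zero) _
∑-≥-term f (suc i) = ≤-trans (∑-≥-term (f ∘ suc) i) (m≤n+m _ (f zero))

∑-ones : ∀ n → ∑[ i < n ] 1 ≡ n
∑-ones zero = refl
∑-ones (suc n) = cong suc (∑-ones n)

count : ∀ {n} {P : Fin n → Set} → (∀ i → Dec (P i)) → ℕ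
count {n} P? = ∑[ i < n ] ι (P? i)

module _ {n} {P Q R : Fin n → Set}
         (P? : ∀ i → Dec (P i)) (Q? : ∀ i → Dec (Q i)) (R? : ∀ i → Dec (R i)) where

  count-cover : (∀ {i} → P i → Q i ⊎ R i) → count P? ≤ count Q? + count R?
  count-cover cover = subst (count P? ≤_) (∑-distrib-+ (ι ∘ Q?) (ι ∘ R?))
    (∑-mono-≤ λ i → ι-cover (P? i) (Q? i) (R? i) cover)

  count-disjoint : (∀ {i} → P i → Q i → ⊥) → (∀ {i} → P i ⊎ Q i → R i) →
                   count P? + count Q? ≤ count R?
  count-disjoint disjoint into = subst (_≤ count R?) (∑-distrib-+ (ι ∘ P?) (ι ∘ Q?))
    (∑-mono-≤ λ i → ι-disjoint (P? i) (Q? i) (R? i) disjoint into)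

module _ {n} {P : Fin n → Set} (P? : ∀ i → Dec (P i)) where

  count-¬ : count P? + count (¬? ∘ P?) ≡ n
  count-¬ = begin
    count P? + count (¬? ∘ P?)           ≡⟨ sym (∑-distrib-+ (ι ∘ P?) (ι ∘ ¬? ∘ P?)) ⟩
    ∑[ i < n ] (ι (P? i) + ι (¬? (P? i))) ≡⟨ sum-cong-≗ (ι-¬ ∘ P?) ⟩
    ∑[ i < n ] 1                          ≡⟨ ∑-ones n ⟩
    n                                     ∎
    where open ≡-Reasoning

  count-witness : ∀ {i} → P i → 1 ≤ count P?
  count-witness {i} p = ≤-trans (≤-reflexive (sym (ι-yes (P? i) p))) (∑-≥-term (ι ∘ P?) i)

count-none : ∀ {n} {P : Fin n → Set} (P? : ∀ i → Dec (P i)) → (∀ i → ¬ P i) → count P? ≡ 0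
count-none {zero} P? _ = refl
count-none {suc n} P? none = cong₂ _+_ (ι-no (P? zero) (none zero)) (count-none (P? ∘ suc) (none ∘ suc))

count-≤1 : ∀ {n} {P : Fin n → Set} (P? : ∀ i → Dec (P i)) →
           (∀ {i j} → P i → P j → i ≡ j) → count P? ≤ 1
count-≤1 {zero} P? _ = z≤n
count-≤1 {suc n} P? unique with P? zero
... | yes p = ≤-reflexive (cong suc (count-none (P? ∘ suc) λ i q → zero≢suc (unique p q)))
  where
  zero≢suc : ∀ {i : Fin n} → zero ≢ suc i
  zero≢suc ()
... | no _ = count-≤1 (P? ∘ suc) λ p q → suc-injective (unique p q)

count-∁-anti : ∀ {n} {P Q : Fin n → Set} (P? : ∀ i → Dec (P i)) (Q? : ∀ i → Dec (Q i)) →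
               count Q? ≤ count P? → count (¬? ∘ P?) ≤ count (¬? ∘ Q?)
count-∁-anti P? Q? Q≤P = +-cancelˡ-≤ (count Q?) _ _ (begin
  count Q? + count (¬? ∘ P?) ≤⟨ +-monoˡ-≤ _ Q≤P ⟩
  count P? + count (¬? ∘ P?) ≡⟨ count-¬ P? ⟩
  _                          ≡⟨ sym (count-¬ Q?) ⟩
  count Q? + count (¬? ∘ Q?) ∎)
  where open ≤-Reasoning

count-≢ : ∀ {n} (ρ : Fin n) → n ∸ 1 ≤ count (λ v → ¬? (v ≟ ρ))
count-≢ {n} ρ = m≤n+o⇒m∸n≤o n 1 (begin
  n                                                   ≡⟨ count-¬ (_≟ ρ) ⟨
  count (_≟ ρ) + count (λ v → ¬? (v ≟ ρ))             ≤⟨ +-monoˡ-≤ _ (count-≤1 (_≟ ρ) λ u≡ρ v≡ρ → trans u≡ρ (sym v≡ρ)) ⟩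
  1 + count (λ v → ¬? (v ≟ ρ))                        ∎)
  where open ≤-Reasoning

count-without : ∀ {n} {P : Fin n → Set} (P? : ∀ i → Dec (P i)) (ρ : Fin n) →
                P ρ ⊎ (∀ v → ¬ P v) → count (λ v → P? v ×-dec ¬? (v ≟ ρ)) ≤ count P? ∸ 1
count-without P? ρ (inj₁ pρ) = m+n≤o⇒m≤o∸n _ (begin
  count (λ v → P? v ×-dec ¬? (v ≟ ρ)) + 1                                       ≤⟨ +-monoʳ-≤ _ (count-witness (λ v → P? v ×-dec v ≟ ρ) (pρ , refl)) ⟩
  count (λ v → P? v ×-dec ¬? (v ≟ ρ)) + count (λ v → P? v ×-dec v ≟ ρ)          ≤⟨ count-disjoint (λ v → P? v ×-dec ¬? (v ≟ ρ)) (λ v → P? v ×-dec v ≟ ρ) P?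
                                                                                     (λ (_ , v≢ρ) (_ , v≡ρ) → v≢ρ v≡ρ) [ proj₁ , proj₁ ] ⟩
  count P?                                                                      ∎)
  where open ≤-Reasoning
count-without P? ρ (inj₂ none) =
  subst (_≤ count P? ∸ 1) (sym (count-none (λ v → P? v ×-dec ¬? (v ≟ ρ)) λ v (pv , _) → none v pv)) z≤n

count₂ : ∀ {m n} {R : Fin m → Fin n → Set} → (∀ i j → Dec (R i j)) → ℕ
count₂ {m} R? = ∑[ i < m ] count (R? i)

count₂-transpose : ∀ {m n} {R : Fin m → Fin n → Set} (R? : ∀ i j → Dec (R i j)) →
                   count₂ (λ j i → R? i j) ≡ count₂ R?
count₂-transpose R? = ∑-comm (λ j i → ι (R? i j))

count-≤-count₂ : ∀ {m n} {P : Fin m → Set} {R : Fin m → Fin n → Set}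
                 (P? : ∀ i → Dec (P i)) (R? : ∀ i j → Dec (R i j)) →
                 (∀ {i} → P i → ∃[ j ] R i j) → count P? ≤ count₂ R?
count-≤-count₂ P? R? witness = ∑-mono-≤ row
  where
  row : ∀ i → ι (P? i) ≤ count (R? i)
  row i with P? i
  ... | yes p = count-witness (R? i) (proj₂ (witness p))
  ... | no _ = z≤n

module _ {m n} {P Q R : Fin m → Fin n → Set} (P? : ∀ i j → Dec (P i j))
         (Q? : ∀ i j → Dec (Q i j)) (R? : ∀ i j → Dec (R i j)) where

  count₂-cover : (∀ {i j} → P i j → Q i j ⊎ R i j) → count₂ P? ≤ count₂ Q? + count₂ R?
  count₂-cover cover = subst (count₂ P? ≤_) (∑-distrib-+ (count ∘ Q?) (count ∘ R?))
    (∑-mono-≤ λ i → count-cover (P? i) (Q? i) (R? i) cover)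

  count₂-disjoint : (∀ {i j} → P i j → Q i j → ⊥) → (∀ {i j} → P i j ⊎ Q i j → R i j) →
                    count₂ P? + count₂ Q? ≤ count₂ R?
  count₂-disjoint disjoint into = subst (_≤ count₂ R?) (∑-distrib-+ (count ∘ P?) (count ∘ Q?))
    (∑-mono-≤ λ i → count-disjoint (P? i) (Q? i) (R? i) disjoint into)

count-injection : ∀ {m n} {P : Fin m → Set} {Q : Fin n → Set}
                  (P? : ∀ i → Dec (P i)) (Q? : ∀ j → Dec (Q j))
                  (f : Fin m → Fin n) (g : Fin n → Fin m) →
                  (∀ {i} → P i → Q (f i)) → (∀ {i} → P i → g (f i) ≡ i) →
                  count P? ≤ count Q?
count-injection P? Q? f g maps-to retraction = begin
  count P?                      ≤⟨ count-≤-count₂ P? graph? (λ p → f _ , p , refl) ⟩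
  count₂ graph?                 ≡⟨ count₂-transpose graph? ⟨
  count₂ (λ j i → graph? i j)   ≤⟨ ∑-mono-≤ fibre ⟩
  count Q?                      ∎
  where
  open ≤-Reasoning
  graph? : ∀ i j → Dec (_ × j ≡ f i)
  graph? i j = P? i ×-dec j ≟ f i
  fibre : ∀ j → count (λ i → graph? i j) ≤ ι (Q? j)
  fibre j with Q? j
  ... | yes _ = count-≤1 (λ i → graph? i j) λ (p , e) (p′ , e′) →
        trans (sym (retraction p)) (trans (cong g (trans (sym e) e′)) (retraction p′))
  ... | no ¬q = ≤-reflexive (count-none (λ i → graph? i j) λ { i (p , refl) → ¬q (maps-to p) })

-- Counting edges

edgeCount : ∀ {n} {R : Fin n → Fin n → Set} → (∀ i j → Dec (R i j)) → ℕ
edgeCount R? = count₂ (λ i j → toℕ i <? toℕ j ×-dec R? i j)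

module _ {n} {R : Fin n → Fin n → Set} (R? : ∀ i j → Dec (R i j))
         (R-sym : ∀ {i j} → R i j → R j i) (R-irrefl : ∀ {i} → ¬ R i i) where

  count₂-≤-2*edgeCount : count₂ R? ≤ edgeCount R? + edgeCount R?
  count₂-≤-2*edgeCount = subst (count₂ R? ≤_)
    (cong (edgeCount R? +_) (count₂-transpose (λ i j → toℕ i <? toℕ j ×-dec R? i j)))
    (count₂-cover R? (λ i j → toℕ i <? toℕ j ×-dec R? i j) (λ i j → toℕ j <? toℕ i ×-dec R? j i) split)
    where
    split : ∀ {i j} → R i j → (toℕ i < toℕ j × R i j) ⊎ (toℕ j < toℕ i × R j i)
    split {i} {j} r with <-cmp (toℕ i) (toℕ j)
    ... | tri< i<j _ _ = inj₁ (i<j , r)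
    ... | tri≈ _ i≡j _ rewrite toℕ-injective i≡j = contradiction r R-irrefl
    ... | tri> _ _ j<i = inj₂ (j<i , R-sym r)

  orientation-≤-edgeCount : ∀ {P : Fin n → Fin n → Set} (P? : ∀ i j → Dec (P i j)) →
    (∀ {i j} → P i j → P j i → ⊥) → (∀ {i j} → P i j → R i j) → count₂ P? ≤ edgeCount R?
  orientation-≤-edgeCount P? P-asym P⊆R = halve (begin
    count₂ P? + count₂ P?                 ≡⟨ cong (count₂ P? +_) (count₂-transpose P?) ⟨
    count₂ P? + count₂ (λ i j → P? j i)   ≤⟨ count₂-disjoint P? (λ i j → P? j i) R? P-asym [ P⊆R , R-sym ∘ P⊆R ] ⟩
    count₂ R?                             ≤⟨ count₂-≤-2*edgeCount ⟩
    edgeCount R? + edgeCount R?           ∎)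
    where
    open ≤-Reasoning
    halve : ∀ {a b} → a + a ≤ b + b → a ≤ b
    halve a+a≤b+b = ≮⇒≥ λ b<a → <⇒≱ (+-mono-< b<a b<a) a+a≤b+b

module _ {n} {P Q R : Fin n → Fin n → Set} (P? : ∀ i j → Dec (P i j))
         (Q? : ∀ i j → Dec (Q i j)) (R? : ∀ i j → Dec (R i j)) where

  edgeCount-disjoint : (∀ {i j} → P i j → Q i j → ⊥) → (∀ {i j} → P i j ⊎ Q i j → R i j) →
                       edgeCount P? + edgeCount Q? ≤ edgeCount R?
  edgeCount-disjoint disjoint into = count₂-disjoint
    (λ i j → toℕ i <? toℕ j ×-dec P? i j) (λ i j → toℕ i <? toℕ j ×-dec Q? i j) (λ i j → toℕ i <? toℕ j ×-dec R? i j)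
    (λ (_ , p) (_ , q) → disjoint p q) [ (λ (i<j , p) → i<j , into (inj₁ p)) , (λ (i<j , q) → i<j , into (inj₂ q)) ]

|E|≡edgeCount : ∀ {n} (G : Graph n) → |E| G ≡ edgeCount (λ i j → T? (adj G i j))
|E|≡edgeCount {n} G = begin
  trues (concat (map row (allFin n)))             ≡⟨ cong (trues ∘ concat) (map-tabulate id row) ⟩
  trues (concat (tabulate row))                   ≡⟨ trues-concat-tabulate row ⟩
  ∑[ i < n ] trues (map (entry i) (allFin n))     ≡⟨ sum-cong-≗ (λ i → cong trues (map-tabulate id (entry i))) ⟩
  ∑[ i < n ] trues (tabulate (entry i))           ≡⟨ sum-cong-≗ (λ i → trues-tabulate (entry i)) ⟩
  ∑[ i < n ] ∑[ j < n ] indicator (entry i j)     ≡⟨ sum-cong-≗ (λ i → sum-cong-≗ λ j →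
                                                       cong (λ b → indicator (b ∧ adj G i j)) (isYes≗does (toℕ i <? toℕ j))) ⟩
  edgeCount (λ i j → T? (adj G i j))              ∎
  where
  open ≡-Reasoning
  indicator : Bool → ℕ
  indicator b = if b then 1 else 0
  trues : List Bool → ℕ
  trues bs = length (filterᵇ id bs)
  entry : Fin n → Fin n → Bool
  entry i j = ⌊ toℕ i <? toℕ j ⌋ ∧ adj G i j
  row : Fin n → List Bool
  row i = map (entry i) (allFin n)
  trues-tabulate : ∀ {m} (b : Fin m → Bool) → trues (tabulate b) ≡ ∑[ i < m ] indicator (b i)
  trues-tabulate {zero} b = refl
  trues-tabulate {suc m} b with b zero
  ... | true = cong suc (trues-tabulate (b ∘ suc))
  ... | false = trues-tabulate (b ∘ suc)
  trues-concat-tabulate : ∀ {m} (f : Fin m → List Bool) → trues (concat (tabulate f)) ≡ ∑[ i < m ] trues (f i)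
  trues-concat-tabulate {zero} f = refl
  trues-concat-tabulate {suc m} f = begin
    trues (f zero ++ concat (tabulate (f ∘ suc)))                    ≡⟨ cong length (filter-++ (T? ∘ id) (f zero) _) ⟩
    length (filterᵇ id (f zero) ++ filterᵇ id (concat (tabulate (f ∘ suc)))) ≡⟨ length-++ (filterᵇ id (f zero)) ⟩
    trues (f zero) + trues (concat (tabulate (f ∘ suc)))             ≡⟨ cong (trues (f zero) +_) (trues-concat-tabulate (f ∘ suc)) ⟩
    trues (f zero) + ∑[ i < m ] trues (f (suc i))                    ∎

subsetOf : ∀ {n} {P : Fin n → Set} → (∀ i → Dec (P i)) → Subset n
subsetOf P? = Vec.tabulate (does ∘ P?)

∈-subsetOf : ∀ {n} {P : Fin n → Set} (P? : ∀ i → Dec (P i)) → ∀ {i} → P i → i ∈ subsetOf P?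
∈-subsetOf P? {i} p = lookup⇒[]= i _ (trans (lookup∘tabulate (does ∘ P?) i) (dec-true (P? i) p))

∣subsetOf∣ : ∀ {n} {P : Fin n → Set} (P? : ∀ i → Dec (P i)) → ∣ subsetOf P? ∣ ≡ count P?
∣subsetOf∣ {zero} _ = refl
∣subsetOf∣ {suc n} P? with P? zero
... | yes _ = cong suc (∣subsetOf∣ (P? ∘ suc))
... | no _ = ∣subsetOf∣ (P? ∘ suc)

∣_∣≡count-∈ : ∀ {n} (W : Subset n) → ∣ W ∣ ≡ count (_∈? W)
∣ [] ∣≡count-∈ = refl
∣ true ∷ W ∣≡count-∈ = cong suc ∣ W ∣≡count-∈
∣ false ∷ W ∣≡count-∈ = ∣ W ∣≡count-∈

-- Walks, leaves and strong resolving sets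

Adj-sym : ∀ {n} (G : Graph n) {u v} → Adj G u v → Adj G v u
Adj-sym G {u} {v} = subst T (Graph.sym G u v)

module _ {n} {G : Graph n} where

  _++ʷ_ : ∀ {u w v a b} → Walk G u w a → Walk G w v b → Walk G u v (a + b)
  here ++ʷ q = q
  step u~ p ++ʷ q = step u~ (p ++ʷ q)

  unsnocʷ : ∀ {u v k} → Walk G u v (suc k) → ∃[ w ] (Walk G u w k × Adj G w v)
  unsnocʷ (step u~v here) = _ , here , u~v
  unsnocʷ (step u~w p@(step _ _)) with unsnocʷ p
  ... | w′ , q , w′~v = w′ , step u~w q , w′~v

  walk-zero : ∀ {u v} → Walk G u v 0 → u ≡ v
  walk-zero here = refl

walk? : ∀ {n} (G : Graph n) u v k → Dec (Walk G u v k)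
walk? G u v zero = map′ (λ { refl → here }) walk-zero (u ≟ v)
walk? G u v (suc k) = map′ (λ (w , u~w , p) → step u~w p) (λ { (step u~w p) → _ , u~w , p })
  (any? λ w → T? (adj G u w) ×-dec walk? G w v k)

IsLeaf : ∀ {n} → Graph n → Fin n → Set
IsLeaf G v = ∃[ w ] (Adj G v w × ∀ w′ → Adj G v w′ → w′ ≡ w)

isLeaf? : ∀ {n} (G : Graph n) v → Dec (IsLeaf G v)
isLeaf? G v = any? λ w → T? (adj G v w) ×-dec all? λ w′ → T? (adj G v w′) →-dec w′ ≟ w

leaf-off-shortest : ∀ {n} {G : Graph n} {x u v} → IsLeaf G u → x ≢ u → u ≢ v → ¬ OnShortest G x u v
leaf-off-shortest {G = G} {x} {u} {v} (w , _ , only-w) x≢u u≢v (_ , _ , x⇝u , u⇝v , _ , shortest) =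
  detour x⇝u u⇝v shortest
  where
  detour : ∀ {a b} → Walk G x u a → Walk G u v b → (∀ k → Walk G x v k → a + b ≤ k) → ⊥
  detour {a} {zero} _ u⇝v _ = u≢v (walk-zero u⇝v)
  detour {zero} {suc b} x⇝u _ _ = x≢u (walk-zero x⇝u)
  detour {suc a} {suc b} x⇝u (step {w = w₁} u~w₁ w₁⇝v) shortest with unsnocʷ x⇝u
  ... | w₀ , x⇝w₀ , w₀~u = <⇒≱ (s≤s (+-monoʳ-≤ a (n≤1+n b))) (shortest (a + b) (x⇝w₀ ++ʷ w₀⇝v))
    where
    -- both path neighbours of u are its only neighbour w, so u can be skipped
    w₀⇝v : Walk G w₀ v b
    w₀⇝v = subst (λ t → Walk G t v b) (trans (only-w w₁ u~w₁) (sym (only-w w₀ (Adj-sym G w₀~u)))) w₁⇝v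

strongResolving-≥-leaves∸1 : ∀ {n} {G : Graph n} {W} → IsStrongResolvingSet G W →
                             count (isLeaf? G) ∸ 1 ≤ ∣ W ∣
strongResolving-≥-leaves∸1 {G = G} {W} resolving = m≤n+o⇒m∸n≤o _ 1 (begin
  count (isLeaf? G)                                ≤⟨ count-cover (isLeaf? G) unresolved? (_∈? W) split ⟩
  count unresolved? + count (_∈? W)                ≤⟨ +-mono-≤ (count-≤1 unresolved? at-most-one) (≤-reflexive (sym ∣ W ∣≡count-∈)) ⟩
  1 + ∣ W ∣                                        ∎)
  where
  open ≤-Reasoning
  unresolved? : ∀ v → Dec (IsLeaf G v × v ∉ W)
  unresolved? v = isLeaf? G v ×-dec ¬? (v ∈? W)
  split : ∀ {v} → IsLeaf G v → (IsLeaf G v × v ∉ W) ⊎ v ∈ W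
  split {v} leaf with v ∈? W
  ... | yes v∈W = inj₂ v∈W
  ... | no v∉W = inj₁ (leaf , v∉W)
  at-most-one : ∀ {u v} → IsLeaf G u × u ∉ W → IsLeaf G v × v ∉ W → u ≡ v
  at-most-one {u} {v} (leaf-u , u∉W) (leaf-v , v∉W) with u ≟ v
  ... | yes u≡v = u≡v
  ... | no u≢v with resolving u v u≢v
  ...   | x , x∈W , inj₁ u-between = contradiction u-between
          (leaf-off-shortest leaf-u (λ { refl → u∉W x∈W }) u≢v)
  ...   | x , x∈W , inj₂ v-between = contradiction v-between
          (leaf-off-shortest leaf-v (λ { refl → v∉W x∈W }) (u≢v ∘ sym))

-- A shortest-path spanning tree

minimal-witness : ∀ {P : ℕ → Set} → (∀ k → Dec (P k)) →
                  ∀ {K} → P K → ∃[ k ] (P k × ∀ {j} → P j → k ≤ j)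
minimal-witness {P} P? {K} = <-rec Goal descend K
  where
  Goal : ℕ → Set
  Goal K = P K → ∃[ k ] (P k × ∀ {j} → P j → k ≤ j)
  descend : ∀ K → (∀ {j} → j < K → Goal j) → Goal K
  descend K below pK with anyUpTo? P? K
  ... | yes (j , j<K , pj) = below j<K pj
  ... | no none = K , pK , λ {j} pj → ≮⇒≥ λ j<K → none (j , j<K , pj)

module ShortestPathTree {n} (G : Graph n) (connected : Connected G) (ρ : Fin n) where

  private
    nearest : ∀ v → ∃[ k ] (Walk G ρ v k × ∀ {j} → Walk G ρ v j → k ≤ j)
    nearest v = minimal-witness (walk? G ρ v) (proj₂ (connected ρ v))

  depth : Fin n → ℕ
  depth v = proj₁ (nearest v)

  depth-walk : ∀ v → Walk G ρ v (depth v)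
  depth-walk v = proj₁ (proj₂ (nearest v))

  depth-minimal : ∀ {v k} → Walk G ρ v k → depth v ≤ k
  depth-minimal = proj₂ (proj₂ (nearest _))

  depth-rec : (P : Fin n → Set) → (∀ v → (∀ {u} → depth u < depth v → P u) → P v) → ∀ v → P v
  depth-rec = All.wfRec (On.wellFounded depth <-wellFounded) 0ℓ

  private
    parentOf : ∀ {v} → v ≢ ρ → ∃[ u ] (Adj G u v × depth u < depth v)
    parentOf {v} v≢ρ with depth v | depth-walk v
    ... | zero | ρ⇝v = contradiction (sym (walk-zero ρ⇝v)) v≢ρ
    ... | suc k | ρ⇝v with unsnocʷ ρ⇝v
    ...   | u , ρ⇝u , u~v = u , u~v , s≤s (depth-minimal ρ⇝u)

  -- parent ρ is a junk value; IsParent u v requires v ≢ ρ.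
  parent : Fin n → Fin n
  parent v with v ≟ ρ
  ... | yes _ = ρ
  ... | no v≢ρ = proj₁ (parentOf v≢ρ)

  parent-spec : ∀ {v} → v ≢ ρ → Adj G (parent v) v × depth (parent v) < depth v
  parent-spec {v} v≢ρ with v ≟ ρ
  ... | yes v≡ρ = contradiction v≡ρ v≢ρ
  ... | no v≢ρ′ = proj₂ (parentOf v≢ρ′)

  IsParent : Fin n → Fin n → Set
  IsParent u v = v ≢ ρ × parent v ≡ u

  isParent? : ∀ u v → Dec (IsParent u v)
  isParent? u v = ¬? (v ≟ ρ) ×-dec parent v ≟ u

  IsParent⇒Adj : ∀ {u v} → IsParent u v → Adj G u v
  IsParent⇒Adj (v≢ρ , refl) = proj₁ (parent-spec v≢ρ)

  IsParent⇒depth< : ∀ {u v} → IsParent u v → depth u < depth v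
  IsParent⇒depth< (v≢ρ , refl) = proj₂ (parent-spec v≢ρ)

  TreeEdge : Fin n → Fin n → Set
  TreeEdge u v = IsParent u v ⊎ IsParent v u

  treeEdge? : ∀ u v → Dec (TreeEdge u v)
  treeEdge? u v = isParent? u v ⊎-dec isParent? v u

  NonTreeEdge : Fin n → Fin n → Set
  NonTreeEdge u v = Adj G u v × ¬ TreeEdge u v

  nonTreeEdge? : ∀ u v → Dec (NonTreeEdge u v)
  nonTreeEdge? u v = T? (adj G u v) ×-dec ¬? (treeEdge? u v)

  TreeEdge⇒Adj : ∀ {u v} → TreeEdge u v → Adj G u v
  TreeEdge⇒Adj (inj₁ u→v) = IsParent⇒Adj u→v
  TreeEdge⇒Adj (inj₂ v→u) = Adj-sym G (IsParent⇒Adj v→u)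

  TreeEdge-irrefl : ∀ {v} → ¬ TreeEdge v v
  TreeEdge-irrefl (inj₁ v→v) = <-irrefl refl (IsParent⇒depth< v→v)
  TreeEdge-irrefl (inj₂ v→v) = <-irrefl refl (IsParent⇒depth< v→v)

  NonTreeEdge-sym : ∀ {u v} → NonTreeEdge u v → NonTreeEdge v u
  NonTreeEdge-sym (u~v , ¬tree) = Adj-sym G u~v , ¬tree ∘ ⊎-swap

  NonTreeEdge-irrefl : ∀ {v} → ¬ NonTreeEdge v v
  NonTreeEdge-irrefl {v} (v~v , _) = subst T (irrefl G v) v~v

  n∸1≤treeEdges : n ∸ 1 ≤ edgeCount treeEdge?
  n∸1≤treeEdges = begin
    n ∸ 1                               ≤⟨ count-≢ ρ ⟩
    count (λ v → ¬? (v ≟ ρ))            ≤⟨ count-≤-count₂ (λ v → ¬? (v ≟ ρ)) (λ v u → isParent? u v) (λ v≢ρ → _ , v≢ρ , refl) ⟩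
    count₂ (λ v u → isParent? u v)      ≡⟨ count₂-transpose isParent? ⟩
    count₂ isParent?                    ≤⟨ orientation-≤-edgeCount treeEdge? ⊎-swap TreeEdge-irrefl isParent?
                                             (λ u→v v→u → <-asym (IsParent⇒depth< u→v) (IsParent⇒depth< v→u)) inj₁ ⟩
    edgeCount treeEdge?                 ∎
    where open ≤-Reasoning

  n∸1+nonTreeEdges≤|E| : n ∸ 1 + edgeCount nonTreeEdge? ≤ |E| G
  n∸1+nonTreeEdges≤|E| = begin
    n ∸ 1 + edgeCount nonTreeEdge?                   ≤⟨ +-monoˡ-≤ _ n∸1≤treeEdges ⟩
    edgeCount treeEdge? + edgeCount nonTreeEdge?     ≤⟨ edgeCount-disjoint treeEdge? nonTreeEdge? (λ i j → T? (adj G i j))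
                                                          (λ tree (_ , ¬tree) → ¬tree tree) [ TreeEdge⇒Adj , proj₁ ] ⟩
    edgeCount (λ i j → T? (adj G i j))               ≡⟨ |E|≡edgeCount G ⟨
    |E| G                                            ∎
    where open ≤-Reasoning

  -- The zero forcing set

  Internal : Fin n → Set
  Internal u = ∃[ v ] IsParent u v

  internal? : ∀ u → Dec (Internal u)
  internal? u = any? (isParent? u)

  root-internal : ∀ {v} → v ≢ ρ → Internal ρ
  root-internal {v} = depth-rec (λ v → v ≢ ρ → Internal ρ) climb v
    where
    climb : ∀ v → (∀ {u} → depth u < depth v → u ≢ ρ → Internal ρ) → v ≢ ρ → Internal ρ
    climb v up v≢ρ with parent v ≟ ρ
    ... | yes parent≡ρ = v , v≢ρ , parent≡ρ
    ... | no parent≢ρ = up (proj₂ (parent-spec v≢ρ)) parent≢ρ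

  -- heir u is a junk value unless u is internal.
  heir : Fin n → Fin n
  heir u with internal? u
  ... | yes (v , _) = v
  ... | no _ = u

  heir-isParent : ∀ {u} → Internal u → IsParent u (heir u)
  heir-isParent {u} internal with internal? u
  ... | yes (_ , u→v) = u→v
  ... | no ¬internal = contradiction internal ¬internal

  IsHeir : Fin n → Set
  IsHeir v = v ≢ ρ × v ≡ heir (parent v)

  isHeir? : ∀ v → Dec (IsHeir v)
  isHeir? v = ¬? (v ≟ ρ) ×-dec v ≟ heir (parent v)

  HasNonTreeEdgeUp : Fin n → Set
  HasNonTreeEdgeUp v = ∃[ a ] (NonTreeEdge v a × depth a < depth v)

  hasNonTreeEdgeUp? : ∀ v → Dec (HasNonTreeEdgeUp v)
  hasNonTreeEdgeUp? v = any? λ a → nonTreeEdge? v a ×-dec depth a <? depth v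

  Seed : Fin n → Set
  Seed v = ¬ IsHeir v ⊎ HasNonTreeEdgeUp v

  seed? : ∀ v → Dec (Seed v)
  seed? v = ¬? (isHeir? v) ⊎-dec hasNonTreeEdgeUp? v

  seeds : Subset n
  seeds = subsetOf seed?

  unseeded⇒heir : ∀ {v} → ¬ Seed v → IsHeir v
  unseeded⇒heir {v} ¬seed with isHeir? v
  ... | yes v-heir = v-heir
  ... | no ¬heir = contradiction (inj₁ ¬heir) ¬seed

  unseeded-sibling-shallower : ∀ {x w} → ¬ Seed x → ¬ Seed w →
    Adj G (parent x) w → w ≢ x → depth w < depth x
  unseeded-sibling-shallower {x} {w} ¬seed-x ¬seed-w u~w w≢x = ≰⇒> not-deeper
    where
    x-heir : IsHeir x
    x-heir = unseeded⇒heir ¬seed-x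
    u<x : depth (parent x) < depth x
    u<x = proj₂ (parent-spec (proj₁ x-heir))
    not-deeper : ¬ depth x ≤ depth w
    not-deeper x≤w with treeEdge? (parent x) w
    ... | yes (inj₁ (_ , parent-w≡u)) = w≢x (begin
          w                 ≡⟨ proj₂ (unseeded⇒heir ¬seed-w) ⟩
          heir (parent w)   ≡⟨ cong heir parent-w≡u ⟩
          heir (parent x)   ≡⟨ proj₂ x-heir ⟨
          x                 ∎)
      where open ≡-Reasoning
    ... | yes (inj₂ w→u) = <⇒≱ (<-trans (IsParent⇒depth< w→u) u<x) x≤w
    ... | no ¬tree = ¬seed-w (inj₂ (parent x , NonTreeEdge-sym (u~w , ¬tree) , <-≤-trans u<x x≤w))

  seeds-force : ∀ v → Black G seeds v
  seeds-force = depth-rec (Black G seeds) black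
    where
    black : ∀ x → (∀ {y} → depth y < depth x → Black G seeds y) → Black G seeds x
    black x ih with seed? x
    ... | yes seed = init (∈-subsetOf seed? seed)
    ... | no ¬seed = force (ih u<x) u~x siblings
      where
      u~x : Adj G (parent x) x
      u~x = proj₁ (parent-spec (proj₁ (unseeded⇒heir ¬seed)))
      u<x : depth (parent x) < depth x
      u<x = proj₂ (parent-spec (proj₁ (unseeded⇒heir ¬seed)))
      siblings : ∀ w → Adj G (parent x) w → w ≢ x → Black G seeds w
      siblings w u~w w≢x with seed? w
      ... | yes seed = init (∈-subsetOf seed? seed)
      ... | no ¬seed-w = ih (unseeded-sibling-shallower ¬seed ¬seed-w u~w w≢x)

  HasNonTreeEdge : Fin n → Set
  HasNonTreeEdge v = ∃[ w ] NonTreeEdge v w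

  hasNonTreeEdge? : ∀ v → Dec (HasNonTreeEdge v)
  hasNonTreeEdge? v = any? (nonTreeEdge? v)

  internal-≤-heirs : count internal? ≤ count isHeir?
  internal-≤-heirs = count-injection internal? isHeir? heir parent
    (λ internal → proj₁ (heir-isParent internal) , cong heir (sym (proj₂ (heir-isParent internal))))
    (λ internal → proj₂ (heir-isParent internal))

  external-leaf-or-nonTree : Internal ρ → ∀ {v} → ¬ Internal v → (IsLeaf G v × v ≢ ρ) ⊎ HasNonTreeEdge v
  external-leaf-or-nonTree root-int {v} ¬internal with hasNonTreeEdge? v
  ... | yes nonTree = inj₂ nonTree
  ... | no ¬nonTree = inj₁ ((parent v , Adj-sym G (proj₁ (parent-spec v≢ρ)) , only-parent) , v≢ρ)
    where
    v≢ρ : v ≢ ρ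
    v≢ρ refl = ¬internal root-int
    only-parent : ∀ w → Adj G v w → w ≡ parent v
    only-parent w v~w with treeEdge? v w
    ... | yes (inj₁ v→w) = contradiction (w , v→w) ¬internal
    ... | yes (inj₂ (_ , parent-v≡w)) = sym parent-v≡w
    ... | no ¬tree = contradiction (w , v~w , ¬tree) ¬nonTree

  nonTreeEdgesUp-≤ : count hasNonTreeEdgeUp? ≤ edgeCount nonTreeEdge?
  nonTreeEdgesUp-≤ = ≤-trans (count-≤-count₂ hasNonTreeEdgeUp? up? id)
    (orientation-≤-edgeCount nonTreeEdge? NonTreeEdge-sym NonTreeEdge-irrefl up?
      (λ (_ , a<v) (_ , v<a) → <-asym a<v v<a) proj₁)
    where
    up? : ∀ v a → Dec (NonTreeEdge v a × depth a < depth v)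
    up? v a = nonTreeEdge? v a ×-dec depth a <? depth v

  nonTreeEdgeEnds-≤ : count hasNonTreeEdge? ≤ edgeCount nonTreeEdge? + edgeCount nonTreeEdge?
  nonTreeEdgeEnds-≤ = ≤-trans (count-≤-count₂ hasNonTreeEdge? nonTreeEdge? id)
    (count₂-≤-2*edgeCount nonTreeEdge? NonTreeEdge-sym NonTreeEdge-irrefl)

  ∣seeds∣-≤ : Internal ρ → IsLeaf G ρ ⊎ (∀ v → ¬ IsLeaf G v) →
              ∣ seeds ∣ ≤ count (isLeaf? G) ∸ 1 + 3 * edgeCount nonTreeEdge?
  ∣seeds∣-≤ root-int root-leaf = begin
    ∣ seeds ∣                                              ≡⟨ ∣subsetOf∣ seed? ⟩
    count seed?                                            ≤⟨ count-cover seed? (¬? ∘ isHeir?) hasNonTreeEdgeUp? id ⟩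
    count (¬? ∘ isHeir?) + count hasNonTreeEdgeUp?         ≤⟨ +-mono-≤ (count-∁-anti isHeir? internal? internal-≤-heirs) nonTreeEdgesUp-≤ ⟩
    count (¬? ∘ internal?) + r                             ≤⟨ +-monoˡ-≤ r (count-cover (¬? ∘ internal?) leaf≢ρ? hasNonTreeEdge?
                                                                              (external-leaf-or-nonTree root-int)) ⟩
    count leaf≢ρ? + count hasNonTreeEdge? + r              ≤⟨ +-monoˡ-≤ r (+-mono-≤ (count-without (isLeaf? G) ρ root-leaf) nonTreeEdgeEnds-≤) ⟩
    count (isLeaf? G) ∸ 1 + (r + r) + r                    ≡⟨ +-assoc (count (isLeaf? G) ∸ 1) (r + r) r ⟩
    count (isLeaf? G) ∸ 1 + (r + r + r)                    ≡⟨ cong (count (isLeaf? G) ∸ 1 +_) (trans (+-assoc r r r) (cong (λ x → r + (r + x)) (sym (+-identityʳ r)))) ⟩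
    count (isLeaf? G) ∸ 1 + 3 * r                          ∎
    where
    open ≤-Reasoning
    r : ℕ
    r = edgeCount nonTreeEdge?
    leaf≢ρ? : ∀ v → Dec (IsLeaf G v × v ≢ ρ)
    leaf≢ρ? v = isLeaf? G v ×-dec ¬? (v ≟ ρ)

cycleRank-≥ : ∀ {m} (G : Graph (suc m)) {r} → m + r ≤ |E| G → r ≤ cycleRank G
cycleRank-≥ {m} G {r} m+r≤E = m+n≤o⇒m≤o∸n r (begin
  r + suc m       ≡⟨ +-suc r m ⟩
  suc (r + m)     ≡⟨ cong suc (+-comm r m) ⟩
  suc (m + r)     ≤⟨ s≤s m+r≤E ⟩
  suc (|E| G)     ≡⟨ +-comm 1 (|E| G) ⟩
  |E| G + 1       ∎)
  where open ≤-Reasoning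

leaf-or-leafless : ∀ {n} (G : Graph (suc n)) → ∃[ ρ ] (IsLeaf G ρ ⊎ ∀ v → ¬ IsLeaf G v)
leaf-or-leafless G with any? (isLeaf? G)
... | yes (ρ , leaf) = ρ , inj₁ leaf
... | no ¬leaf = zero , inj₂ λ v leaf → ¬leaf (v , leaf)

another-vertex : ∀ {m} (ρ : Fin (suc (suc m))) → ∃[ v ] v ≢ ρ
another-vertex zero = suc zero , λ ()
another-vertex (suc _) = zero , λ ()

proposition4p1 : ∀ (n : ℕ) (G : Graph n) → 2 ≤ n → Connected G →
    ∀ (z s : ℕ) → IsZ G z → IsSdim G s → z ≤ s + 3 * cycleRank G
proposition4p1 .(suc (suc m)) G (s≤s (s≤s {n = m} z≤n)) connected z s (_ , z-minimal) ((W , resolving , ∣W∣≡s) , _) = begin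
  z                                               ≤⟨ z-minimal seeds seeds-force ⟩
  ∣ seeds ∣                                       ≤⟨ ∣seeds∣-≤ (root-internal (proj₂ (another-vertex ρ))) (proj₂ root) ⟩
  count (isLeaf? G) ∸ 1 + 3 * edgeCount nonTreeEdge? ≤⟨ +-mono-≤ (subst (_ ≤_) ∣W∣≡s (strongResolving-≥-leaves∸1 resolving))
                                                       (*-monoʳ-≤ 3 (cycleRank-≥ G n∸1+nonTreeEdges≤|E|)) ⟩
  s + 3 * cycleRank G                             ∎
  where
  open ≤-Reasoning
  root : ∃[ ρ ] (IsLeaf G ρ ⊎ ∀ v → ¬ IsLeaf G v)
  root = leaf-or-leafless G
  ρ : Fin (suc (suc m))
  ρ = proj₁ root
  open ShortestPathTree G connected ρ
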